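{- Let $\Gamma$ be a group that is nilpotent of class $\le n$, $S$ a generating set, $G=\mathrm{Cay}(\Gamma,S)$, and $r\ge 2^{n+2}$ an integer. Let $h\in S$ be such that $X:=\{\mathbb{I},h\}$ is an $r$-local $2$-separator of $G$, suppose $G$ has no $r$-local cutvertex, and suppose $h$ is not an involution. Then there is no $g\in S$ such that all of the following hold: $g$ traverses $X$ at $\mathbb{I}$; the word $gh^2$ strongly traverses $X$; and both $g^{ -1}h^2g^{ -1}h^{ -1}$ and $ghgh$ are morphemes of $\Gamma$ in $S$.
   Context: Generating sets $S\subseteq\Gamma\setminus\{\mathbb{I}\}$ are closed under inverses; $\mathrm{Cay}(\Gamma,S)$ is the simple graph on $\Gamma$ with edges $\{g,gs\}$. $g\equiv h$ means $g=h$ or $g=h^{ -1}$. Nilpotency (paper's definition): with words $[g,h]_1:=gh^{ -1}g^{ -1}h$ and $[g,h]_n:=[g,[g,h]_{n-1}]_1$ (freely reduced), $\Gamma$ is nilpotent of class $\le n$ if $[g,h]_n=\mathbb{I}$ for all $g\not\equiv h$. The ball $B_r(v)$ consists of all vertices and edges on closed walks of length $\le r$ through $v$; $v$ is an $r$-local cutvertex if $B_r(v)-v$ is disconnected. For distinct vertices $v_0,v_1$ the connectivity graph $C_r(v_0,v_1)$ has vertex set $N(\{v_0,v_1\})$ (vertices outside $\{v_0,v_1\}$ adjacent to one of them), with $a,b$ adjacent if for some $i$ they lie in the same component of $B_r(v_i)-v_0-v_1$; $\{v_0,v_1\}$ is an $r$-local $2$-separator if $C_r(v_0,v_1)$ is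 disconnected and $d(v_0,v_1)\le r/2$; its $r$-local components are the components of $C_r(v_0,v_1)$. A word in $S$ is a finite sequence of elements of $S$; it is an identity word if nonempty with product $\mathbb{I}$ in $\Gamma$; a morpheme is an identity word none of whose nonempty proper (contiguous) subwords is an identity word. For $g\in S$ and $x\in X$: $g$ traverses $X$ at $x$ if the vertices $xg^{ -1}$ and $xg$ lie in distinct $r$-local components at $X$. A word $a_1a_2a_3$ of length three strongly traverses $X$ if there is $v\in\Gamma$ such that $va_1$ and $va_1a_2$ are the two vertices of $X$ and $v$, $va_1a_2a_3$ lie in distinct $r$-local components at $X$. -}

module Defs where

open import Level using (Level; _⊔_)
open import Algebra.Bundles using (Group)
open import Data.Nat using (ℕ; zero; suc; _≤_; _*_)
open import Data.List using (List; []; _∷_; _++_; foldr)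
open import Data.List.Relation.Unary.All using (All)
open import Data.Product using (Σ; ∃; _×_; _,_)
open import Data.Sum using (_⊎_)
open import Relation.Nullary using (¬_)
open import Relation.Binary.PropositionalEquality using (_≢_)
open import Relation.Unary using (Pred)

module Cayley {c ℓ p : Level} (Γ : Group c ℓ) (S : Pred (Group.Carrier Γ) p) where
  open Group Γ

  _≡±_ : Carrier → Carrier → Set ℓ
  g ≡± h = (g ≈ h) ⊎ (g ≈ h ⁻¹)

  comm1 : Carrier → Carrier → Carrier
  comm1 g h = g ∙ (h ⁻¹ ∙ (g ⁻¹ ∙ h))

  commN : ℕ → Carrier → Carrier → Carrier
  commN zero    g h = h      -- convention [g,h]_0 := h (paper defines n ≥ 1)
  commN (suc zero) g h = comm1 g h
  commN (suc (suc n)) g h = comm1 g (commN (suc n) g h)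

  -- nilpotent of class ≤ n (paper's definition). With [g,h]_0 := h,
  -- class ≤ 0 forces Γ trivial, the usual convention.
  NilpotentClass≤ : ℕ → Set (c ⊔ ℓ)
  NilpotentClass≤ n = ∀ g h → ¬ (g ≡± h) → commN n g h ≈ ε

  prod : List Carrier → Carrier
  prod = foldr _∙_ ε

  IsWord : List Carrier → Set (c ⊔ p)
  IsWord = All S

  record GeneratingSet : Set (c ⊔ ℓ ⊔ p) where
    field
      respects   : ∀ {x y} → x ≈ y → S x → S y
      nonId      : ∀ {s} → S s → ¬ (s ≈ ε)
      invClosed  : ∀ {s} → S s → S (s ⁻¹)
      generates  : ∀ x → Σ (List Carrier) λ w → IsWord w × (prod w ≈ x)

  IdentityWord : List Carrier → Set (c ⊔ ℓ ⊔ p)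
  IdentityWord w = IsWord w × (w ≢ []) × (prod w ≈ ε)

  ProperSubword : List Carrier → List Carrier → Set c
  ProperSubword m w = Σ (List Carrier) λ a → Σ (List Carrier) λ b →
    (w Relation.Binary.PropositionalEquality.≡ a ++ (m ++ b)) × (m ≢ []) × ¬ ((a Relation.Binary.PropositionalEquality.≡ []) × (b Relation.Binary.PropositionalEquality.≡ []))

  Morpheme : List Carrier → Set (c ⊔ ℓ ⊔ p)
  Morpheme w = IdentityWord w × (∀ m → ProperSubword m w → ¬ IdentityWord m)

  Adj : Carrier → Carrier → Set (c ⊔ ℓ ⊔ p)
  Adj x y = Σ Carrier λ s → S s × (y ≈ x ∙ s)

  data Walk : Carrier → Carrier → ℕ → Set (c ⊔ ℓ ⊔ p) where
    nil  : ∀ {x y} → x ≈ y → Walk x y zero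
    cons : ∀ {x y z n} → Adj x y → Walk y z n → Walk x z (suc n)

  data VertexOn (u : Carrier) : ∀ {x y n} → Walk x y n → Set (c ⊔ ℓ ⊔ p) where
    atNil  : ∀ {x y} {e : x ≈ y} → u ≈ x → VertexOn u (nil e)
    atHead : ∀ {x y z n} {a : Adj x y} {w : Walk y z n} → u ≈ x → VertexOn u (cons a w)
    later  : ∀ {x y z n} {a : Adj x y} {w : Walk y z n} → VertexOn u w → VertexOn u (cons a w)

  data StepOn (a b : Carrier) : ∀ {x y n} → Walk x y n → Set (c ⊔ ℓ ⊔ p) where
    here  : ∀ {x y z n} {e : Adj x y} {w : Walk y z n} → a ≈ x → b ≈ y → StepOn a b (cons e w)
    there : ∀ {x y z n} {e : Adj x y} {w : Walk y z n} → StepOn a b w → StepOn a b (cons e w)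

  Dist≤ : Carrier → Carrier → ℕ → Set (c ⊔ ℓ ⊔ p)
  Dist≤ x y k = Σ ℕ λ m → (m ≤ k) × Walk x y m

  -- The ball B_r(v): vertices and edges on closed walks of length ≤ r
  -- through v (w.l.o.g. starting and ending at v)

  BallV : ℕ → Carrier → Carrier → Set (c ⊔ ℓ ⊔ p)
  BallV r v u = Σ ℕ λ n → (n ≤ r) × Σ (Walk v v n) λ w → VertexOn u w

  BallE : ℕ → Carrier → Carrier → Carrier → Set (c ⊔ ℓ ⊔ p)
  BallE r v a b = Σ ℕ λ n → (n ≤ r) × Σ (Walk v v n) λ w → StepOn a b w ⊎ StepOn b a w

  data Reach {q} (V : Carrier → Set q) (E : Carrier → Carrier → Set q)
             : Carrier → Carrier → Set (c ⊔ ℓ ⊔ q) where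
    stay : ∀ {a b} → V a → a ≈ b → Reach V E a b
    step : ∀ {a b d} → V a → E a b → Reach V E b d → Reach V E a d

  Disconnected : ∀ {q} (V : Carrier → Set q) (E : Carrier → Carrier → Set q) → Set (c ⊔ ℓ ⊔ q)
  Disconnected V E = Σ Carrier λ a → Σ Carrier λ b → V a × V b × ¬ Reach V E a b

  BallMinusV : ℕ → Carrier → (Carrier → Set ℓ) → Carrier → Set (c ⊔ ℓ ⊔ p)
  BallMinusV r v R u = BallV r v u × ¬ R u

  BallMinusE : ℕ → Carrier → (Carrier → Set ℓ) → Carrier → Carrier → Set (c ⊔ ℓ ⊔ p)
  BallMinusE r v R a b = BallE r v a b × ¬ R a × ¬ R b

  LocalCutvertex : ℕ → Carrier → Set (c ⊔ ℓ ⊔ p)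
  LocalCutvertex r v = Disconnected (BallMinusV r v (_≈ v)) (BallMinusE r v (_≈ v))

  Rem : Carrier → Carrier → Carrier → Set ℓ
  Rem v₀ v₁ u = (u ≈ v₀) ⊎ (u ≈ v₁)

  CV : Carrier → Carrier → Carrier → Set (c ⊔ ℓ ⊔ p)
  CV v₀ v₁ u = ¬ Rem v₀ v₁ u × (Adj v₀ u ⊎ Adj v₁ u)

  SameComp : ℕ → Carrier → Carrier → Carrier → Carrier → Carrier → Set (c ⊔ ℓ ⊔ p)
  SameComp r v v₀ v₁ a b = Reach (BallMinusV r v (Rem v₀ v₁)) (BallMinusE r v (Rem v₀ v₁)) a b

  CE : ℕ → Carrier → Carrier → Carrier → Carrier → Set (c ⊔ ℓ ⊔ p)
  CE r v₀ v₁ a b = SameComp r v₀ v₀ v₁ a b ⊎ SameComp r v₁ v₀ v₁ a b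

  -- {v₀,v₁} is an r-local 2-separator (d(v₀,v₁) ≤ r/2 read as 2·d ≤ r)
  Local2Separator : ℕ → Carrier → Carrier → Set (c ⊔ ℓ ⊔ p)
  Local2Separator r v₀ v₁ =
    ¬ (v₀ ≈ v₁) × Disconnected (CV v₀ v₁) (CE r v₀ v₁) × Σ ℕ λ d → (2 * d ≤ r) × Dist≤ v₀ v₁ d

  DistinctComponents : ℕ → Carrier → Carrier → Carrier → Carrier → Set (c ⊔ ℓ ⊔ p)
  DistinctComponents r v₀ v₁ a b = CV v₀ v₁ a × CV v₀ v₁ b × ¬ Reach (CV v₀ v₁) (CE r v₀ v₁) a b

  Traverses : ℕ → Carrier → Carrier → Carrier → Carrier → Set (c ⊔ ℓ ⊔ p)
  Traverses r v₀ v₁ g x = Rem v₀ v₁ x × DistinctComponents r v₀ v₁ (x ∙ g ⁻¹) (x ∙ g)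

  StronglyTraverses : ℕ → Carrier → Carrier → Carrier → Carrier → Carrier → Set (c ⊔ ℓ ⊔ p)
  StronglyTraverses r v₀ v₁ a₁ a₂ a₃ = Σ Carrier λ v →
    (((v ∙ a₁ ≈ v₀) × ((v ∙ a₁) ∙ a₂ ≈ v₁)) ⊎ ((v ∙ a₁ ≈ v₁) × ((v ∙ a₁) ∙ a₂ ≈ v₀)))
    × DistinctComponents r v₀ v₁ v (((v ∙ a₁) ∙ a₂) ∙ a₃)

{-# OPTIONS --safe #-}
module Submission where

-- Put u = hg and G = g⁻¹g⁻¹h. The two morphemes give u² = 𝕀, h³ = 𝕀 and uGu = G⁻¹, so
-- [u,G]_n = G^(2^n) and nilpotency forces G^(2^n) = 𝕀. The word (g⁻¹g⁻¹h)^(2^n) then spells a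
-- closed walk through 𝕀 of length 3·2^n ≤ r, which lies in B_r(𝕀). Follow it from g⁻¹ until it
-- first re-enters X = {𝕀,h}. It cannot enter h along a g⁻¹-edge, as then a power of G would equal
-- u or h², which the relations and the minimality of the morphemes exclude; nor along an h-edge,
-- which would start at 𝕀. So it enters 𝕀 from g or from h⁻¹ = h², and that vertex lies in the
-- r-local component of g⁻¹, contradicting that g traverses X at 𝕀 and that gh² strongly traverses X.

open import Defs
open import Level using (Level)
open import Algebra.Bundles using (Group)
open import Data.Nat using (ℕ; _≤_; _^_; _+_)
open import Data.List using (List; []; _∷_)
open import Data.Product using (Σ; _×_)
open import Relation.Nullary using (¬_)
open import Relation.Unary using (Pred)

open import Level using (_⊔_)
open import Data.Nat using (zero; suc; _*_; NonZero; s≤s; z≤n)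
open import Data.Nat.Properties using (*-comm; +-identityʳ; ≤-trans; ≤-reflexive; n≤1+n; m≤n+m; *-monoʳ-≤; ^-monoʳ-≤; ^-distribˡ-+-*; m^n≢0)
open import Data.List.Relation.Unary.All using ([]; _∷_)
open import Data.Product using (_,_; proj₁)
open import Data.Sum using (_⊎_; inj₁; inj₂)
open import Data.Empty using (⊥)
open import Relation.Binary.Definitions using (_Respects_)
open import Relation.Nullary.Decidable using (Dec; yes; no; ¬¬-excluded-middle)
import Relation.Binary.PropositionalEquality as ≡
import Algebra.Properties.Group as GroupProperties
import Algebra.Properties.Monoid.Mult as MonoidMult
import Algebra.Solver.Monoid as MonoidSolver
import Relation.Binary.Reasoning.Setoid as SetoidReasoning

module GroupPowers {c ℓ} (Γ : Group c ℓ) where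
  open Group Γ
  open GroupProperties Γ using (⁻¹-anti-homo-∙; ⁻¹-involutive; ⁻¹-injective; ε⁻¹≈ε)
  open SetoidReasoning setoid
  module Mult = MonoidMult monoid

  infixr 8 _^ᴳ_
  _^ᴳ_ : Carrier → ℕ → Carrier
  x ^ᴳ n = n Mult.× x

  ^ᴳ-congˡ : ∀ {x y} n → x ≈ y → x ^ᴳ n ≈ y ^ᴳ n
  ^ᴳ-congˡ n = Mult.×-congʳ n

  ^ᴳ-comm : ∀ x m → x ∙ x ^ᴳ m ≈ x ^ᴳ m ∙ x
  ^ᴳ-comm x zero    = trans (identityʳ x) (sym (identityˡ x))
  ^ᴳ-comm x (suc m) = trans (∙-congˡ (^ᴳ-comm x m)) (sym (assoc x (x ^ᴳ m) x))

  ^ᴳ-double : ∀ x k → x ^ᴳ (2 ^ suc k) ≈ x ^ᴳ (2 ^ k) ∙ x ^ᴳ (2 ^ k)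
  ^ᴳ-double x k = trans (Mult.×-homo-+ x m (m + 0)) (∙-congˡ (Mult.×-congˡ (+-identityʳ m)))
    where m = 2 ^ k

  ε^ᴳ : ∀ m → ε ^ᴳ m ≈ ε
  ε^ᴳ zero    = refl
  ε^ᴳ (suc m) = trans (identityˡ _) (ε^ᴳ m)

  ^ᴳ-^ᴳ-≈ε : ∀ {x} m n → x ^ᴳ n ≈ ε → (x ^ᴳ m) ^ᴳ n ≈ ε
  ^ᴳ-^ᴳ-≈ε {x} m n xⁿ≈ε = begin
    (x ^ᴳ m) ^ᴳ n  ≈⟨ Mult.×-assocˡ x n m ⟩
    x ^ᴳ (n * m)   ≡⟨ ≡.cong (x ^ᴳ_) (*-comm n m) ⟩
    x ^ᴳ (m * n)   ≈⟨ Mult.×-assocˡ x m n ⟨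
    (x ^ᴳ n) ^ᴳ m  ≈⟨ ^ᴳ-congˡ m xⁿ≈ε ⟩
    ε ^ᴳ m         ≈⟨ ε^ᴳ m ⟩
    ε              ∎

  involution-powers : ∀ {x} → x ∙ x ≈ ε → ∀ m → x ^ᴳ m ≈ ε ⊎ x ^ᴳ m ≈ x
  involution-powers x∙x≈ε zero = inj₁ refl
  involution-powers {x} x∙x≈ε (suc m) with involution-powers x∙x≈ε m
  ... | inj₁ xᵐ≈ε = inj₂ (trans (∙-congˡ xᵐ≈ε) (identityʳ x))
  ... | inj₂ xᵐ≈x = inj₁ (trans (∙-congˡ xᵐ≈x) x∙x≈ε)

  x∙x≈ε⇒x^2^suc≈ε : ∀ {x} → x ∙ x ≈ ε → ∀ k → x ^ᴳ (2 ^ suc k) ≈ ε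
  x∙x≈ε⇒x^2^suc≈ε {x} x∙x≈ε zero = trans (∙-congˡ (identityʳ x)) x∙x≈ε
  x∙x≈ε⇒x^2^suc≈ε {x} x∙x≈ε (suc k) =
    trans (^ᴳ-double x (suc k)) (trans (∙-cong ih ih) (identityʳ ε))
    where
    ih : x ^ᴳ (2 ^ suc k) ≈ ε
    ih = x∙x≈ε⇒x^2^suc≈ε x∙x≈ε k

  -- 2^k is prime to 3, so the powers x^(2^k) alternate between x and x⁻¹.
  x∙x≈x⁻¹⇒x^2^k≈ε⇒x≈ε : ∀ {x} k → x ∙ x ≈ x ⁻¹ → x ^ᴳ (2 ^ k) ≈ ε → x ≈ ε
  x∙x≈x⁻¹⇒x^2^k≈ε⇒x≈ε {x} k x∙x≈x⁻¹ x^2^k≈ε = conclude (alternates k)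
    where
    x⁻¹∙x⁻¹≈x : x ⁻¹ ∙ x ⁻¹ ≈ x
    x⁻¹∙x⁻¹≈x = begin
      x ⁻¹ ∙ x ⁻¹   ≈⟨ ⁻¹-anti-homo-∙ x x ⟨
      (x ∙ x) ⁻¹    ≈⟨ ⁻¹-cong x∙x≈x⁻¹ ⟩
      x ⁻¹ ⁻¹       ≈⟨ ⁻¹-involutive x ⟩
      x             ∎

    alternates : ∀ j → x ^ᴳ (2 ^ j) ≈ x ⊎ x ^ᴳ (2 ^ j) ≈ x ⁻¹
    alternates zero = inj₁ (identityʳ x)
    alternates (suc j) with alternates j
    ... | inj₁ e = inj₂ (trans (^ᴳ-double x j) (trans (∙-cong e e) x∙x≈x⁻¹))
    ... | inj₂ e = inj₁ (trans (^ᴳ-double x j) (trans (∙-cong e e) x⁻¹∙x⁻¹≈x))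

    conclude : x ^ᴳ (2 ^ k) ≈ x ⊎ x ^ᴳ (2 ^ k) ≈ x ⁻¹ → x ≈ ε
    conclude (inj₁ x^2^k≈x)   = trans (sym x^2^k≈x) x^2^k≈ε
    conclude (inj₂ x^2^k≈x⁻¹) = ⁻¹-injective (trans (trans (sym x^2^k≈x⁻¹) x^2^k≈ε) (sym ε⁻¹≈ε))

module Commutators {c ℓ p} (Γ : Group c ℓ) (S : Pred (Group.Carrier Γ) p) where
  open Group Γ
  open GroupProperties Γ using (inverseʳ-unique; ⁻¹-anti-homo-∙; ⁻¹-involutive; ε⁻¹≈ε)
  open Cayley Γ S
  open GroupPowers Γ
  open SetoidReasoning setoid
  open MonoidSolver monoid using (solve; _⊜_; _⊕_; id)

  self-inverse-≡± : ∀ {u y} → u ⁻¹ ≈ u → u ≡± y → u ≈ y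
  self-inverse-≡± _ (inj₁ u≈y) = u≈y
  self-inverse-≡± {u} {y} u⁻¹≈u (inj₂ u≈y⁻¹) = begin
    u        ≈⟨ u⁻¹≈u ⟨
    u ⁻¹     ≈⟨ ⁻¹-cong u≈y⁻¹ ⟩
    y ⁻¹ ⁻¹  ≈⟨ ⁻¹-involutive y ⟩
    y        ∎

  Inverts : Carrier → Carrier → Set ℓ
  Inverts u y = u ∙ y ∙ u ≈ y ⁻¹

  comm1-congʳ : ∀ {u y z} → y ≈ z → comm1 u y ≈ comm1 u z
  comm1-congʳ y≈z = ∙-congˡ (∙-cong (⁻¹-cong y≈z) (∙-congˡ y≈z))

  module _ {u : Carrier} (u∙u≈ε : u ∙ u ≈ ε) where

    u⁻¹≈u : u ⁻¹ ≈ u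
    u⁻¹≈u = sym (inverseʳ-unique u u u∙u≈ε)

    inverts-resp : ∀ {y z} → y ≈ z → Inverts u y → Inverts u z
    inverts-resp y≈z uyu≈y⁻¹ =
      trans (∙-congʳ (∙-congˡ (sym y≈z))) (trans uyu≈y⁻¹ (⁻¹-cong y≈z))

    inverts-square : ∀ {y} → Inverts u y → Inverts u (y ∙ y)
    inverts-square {y} uyu≈y⁻¹ = begin
      u ∙ (y ∙ y) ∙ u              ≈⟨ solve 2 (λ u y → (u ⊕ (y ⊕ y)) ⊕ u ⊜ (((u ⊕ y) ⊕ id) ⊕ y) ⊕ u) refl u y ⟩
      u ∙ y ∙ ε ∙ y ∙ u            ≈⟨ ∙-congʳ (∙-congʳ (∙-congˡ u∙u≈ε)) ⟨
      u ∙ y ∙ (u ∙ u) ∙ y ∙ u      ≈⟨ solve 2 (λ u y → (((u ⊕ y) ⊕ (u ⊕ u)) ⊕ y) ⊕ u ⊜ ((u ⊕ y) ⊕ u) ⊕ ((u ⊕ y) ⊕ u)) refl u y ⟩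
      (u ∙ y ∙ u) ∙ (u ∙ y ∙ u)    ≈⟨ ∙-cong uyu≈y⁻¹ uyu≈y⁻¹ ⟩
      y ⁻¹ ∙ y ⁻¹                  ≈⟨ ⁻¹-anti-homo-∙ y y ⟨
      (y ∙ y) ⁻¹                   ∎

    inverts-^2^ : ∀ {y} → Inverts u y → ∀ k → Inverts u (y ^ᴳ (2 ^ k))
    inverts-^2^ {y} uyu≈y⁻¹ zero = inverts-resp (sym (identityʳ y)) uyu≈y⁻¹
    inverts-^2^ {y} uyu≈y⁻¹ (suc k) =
      inverts-resp (sym (^ᴳ-double y k)) (inverts-square (inverts-^2^ uyu≈y⁻¹ k))

    comm1-inverted : ∀ {y} → Inverts u y → comm1 u y ≈ y ∙ y
    comm1-inverted {y} uyu≈y⁻¹ = begin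
      u ∙ (y ⁻¹ ∙ (u ⁻¹ ∙ y))  ≈⟨ ∙-congˡ (∙-congˡ (∙-congʳ u⁻¹≈u)) ⟩
      u ∙ (y ⁻¹ ∙ (u ∙ y))     ≈⟨ solve 3 (λ u y⁻ y → u ⊕ (y⁻ ⊕ (u ⊕ y)) ⊜ ((u ⊕ y⁻) ⊕ u) ⊕ y) refl u (y ⁻¹) y ⟩
      u ∙ y ⁻¹ ∙ u ∙ y         ≈⟨ ∙-congʳ uy⁻¹u≈y ⟩
      y ∙ y                    ∎
      where
      uy⁻¹u≈y : u ∙ y ⁻¹ ∙ u ≈ y
      uy⁻¹u≈y = begin
        u ∙ y ⁻¹ ∙ u              ≈⟨ ∙-cong (∙-congʳ u⁻¹≈u) u⁻¹≈u ⟨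
        u ⁻¹ ∙ y ⁻¹ ∙ u ⁻¹        ≈⟨ ∙-congʳ (⁻¹-anti-homo-∙ y u) ⟨
        (y ∙ u) ⁻¹ ∙ u ⁻¹         ≈⟨ ⁻¹-anti-homo-∙ u (y ∙ u) ⟨
        (u ∙ (y ∙ u)) ⁻¹          ≈⟨ ⁻¹-cong (sym (assoc u y u)) ⟩
        (u ∙ y ∙ u) ⁻¹            ≈⟨ ⁻¹-cong uyu≈y⁻¹ ⟩
        y ⁻¹ ⁻¹                   ≈⟨ ⁻¹-involutive y ⟩
        y                         ∎

    commN-inverted : ∀ {y} → Inverts u y → ∀ k → commN (suc k) u y ≈ y ^ᴳ (2 ^ suc k)
    commN-inverted {y} uyu≈y⁻¹ zero =
      trans (comm1-inverted uyu≈y⁻¹) (sym (trans (^ᴳ-double y 0) (∙-cong (identityʳ y) (identityʳ y))))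
    commN-inverted {y} uyu≈y⁻¹ (suc k) = begin
      comm1 u (commN (suc k) u y)        ≈⟨ comm1-congʳ (commN-inverted uyu≈y⁻¹ k) ⟩
      comm1 u (y ^ᴳ (2 ^ suc k))         ≈⟨ comm1-inverted (inverts-^2^ uyu≈y⁻¹ (suc k)) ⟩
      y ^ᴳ (2 ^ suc k) ∙ y ^ᴳ (2 ^ suc k) ≈⟨ ^ᴳ-double y (suc k) ⟨
      y ^ᴳ (2 ^ suc (suc k))             ∎

  -- For n = 0 apply nilpotency to the pair (ε, y); otherwise to (u, y), unless u ≡± y, when already y ∙ y ≈ u ∙ u ≈ ε.
  nilpotent⇒inverted-2^-torsion : ∀ n {u y} → NilpotentClass≤ n → u ∙ u ≈ ε → Inverts u y →
                                   ¬ ¬ (y ^ᴳ (2 ^ n) ≈ ε)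
  nilpotent⇒inverted-2^-torsion zero {y = y} nilp _ _ y≉ε =
    ¬¬-excluded-middle (λ ε≡±y? → y≉ε (trans (identityʳ y) (y≈ε ε≡±y?)))
    where
    y≈ε : Dec (ε ≡± y) → y ≈ ε
    y≈ε (yes ε≡±y) = sym (self-inverse-≡± ε⁻¹≈ε ε≡±y)
    y≈ε (no ε≢±y)  = nilp ε y ε≢±y
  nilpotent⇒inverted-2^-torsion (suc k) {u} {y} nilp u∙u≈ε uyu≈y⁻¹ y≉ε =
    ¬¬-excluded-middle (λ u≡±y? → y≉ε (y^2^n≈ε u≡±y?))
    where
    y^2^n≈ε : Dec (u ≡± y) → y ^ᴳ (2 ^ suc k) ≈ ε
    y^2^n≈ε (yes u≡±y) = x∙x≈ε⇒x^2^suc≈ε (trans (∙-cong (sym u≈y) (sym u≈y)) u∙u≈ε) k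
      where
      u≈y : u ≈ y
      u≈y = self-inverse-≡± (u⁻¹≈u u∙u≈ε) u≡±y
    y^2^n≈ε (no u≢±y)  = trans (sym (commN-inverted u∙u≈ε uyu≈y⁻¹ k)) (nilp u y u≢±y)

module CayleyGraph {c ℓ p} (Γ : Group c ℓ) (S : Pred (Group.Carrier Γ) p) where
  open Group Γ
  open GroupProperties Γ using (x≈z//y)
  open Cayley Γ S

  Rem-resp : ∀ {v₀ v₁} → Rem v₀ v₁ Respects _≈_
  Rem-resp x≈y (inj₁ x≈v₀) = inj₁ (trans (sym x≈y) x≈v₀)
  Rem-resp x≈y (inj₂ x≈v₁) = inj₂ (trans (sym x≈y) x≈v₁)

  SameLocalComponent : ℕ → Carrier → Carrier → Carrier → Carrier → Set (c ⊔ ℓ ⊔ p)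
  SameLocalComponent r v₀ v₁ = Reach (CV v₀ v₁) (CE r v₀ v₁)

  reach-≈ʳ : ∀ {q} {V : Carrier → Set q} {E : Carrier → Carrier → Set q} {a b b′} →
             Reach V E a b → b ≈ b′ → Reach V E a b′
  reach-≈ʳ (stay Va a≈b) b≈b′ = stay Va (trans a≈b b≈b′)
  reach-≈ʳ (step Va Eab rest) b≈b′ = step Va Eab (reach-≈ʳ rest b≈b′)

  vertexOn-start : ∀ {a x y n} → a ≈ x → (w : Walk x y n) → VertexOn a w
  vertexOn-start a≈x (nil _)    = atNil a≈x
  vertexOn-start a≈x (cons _ _) = atHead a≈x

  stepOn-source : ∀ {a b x y n} {w : Walk x y n} → StepOn a b w → VertexOn a w
  stepOn-source (here a≈x _) = atHead a≈x
  stepOn-source (there s)    = later (stepOn-source s)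

  stepOn-target : ∀ {a b x y n} {w : Walk x y n} → StepOn a b w → VertexOn b w
  stepOn-target {w = cons _ w} (here _ b≈y) = later (vertexOn-start b≈y w)
  stepOn-target (there s) = later (stepOn-target s)

  stepOn-adj : ∀ {a b x y n} {w : Walk x y n} → StepOn a b w → Adj a b
  stepOn-adj (here {e = s , Ss , y≈xs} a≈x b≈y) = s , Ss , trans b≈y (trans y≈xs (∙-congʳ (sym a≈x)))
  stepOn-adj (there st) = stepOn-adj st

  adj-respˡ : ∀ {x x′ y} → x ≈ x′ → Adj x y → Adj x′ y
  adj-respˡ x≈x′ (s , Ss , y≈x∙s) = s , Ss , trans y≈x∙s (∙-congʳ x≈x′)

  ballE⇒ballV : ∀ {r v a b} → BallE r v a b → BallV r v a
  ballE⇒ballV (n , n≤r , w , inj₁ s) = n , n≤r , w , stepOn-source s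
  ballE⇒ballV (n , n≤r , w , inj₂ s) = n , n≤r , w , stepOn-target s

  -- Whether a vertex lies in R is not decidable, so the first exit exists only up to double negation.
  first-exit : ∀ {r v} {R : Carrier → Set ℓ} → R Respects _≈_ → ∀ {a b m} (w : Walk a b m) →
               (∀ {c d} → StepOn c d w → BallE r v c d) → ¬ R a → R b →
               ¬ ¬ (Σ Carrier λ c → Σ Carrier λ d → StepOn c d w
                     × Reach (BallMinusV r v R) (BallMinusE r v R) a c × ¬ R c × R d)
  first-exit R-resp (nil a≈b) _ ¬Ra Rb _ = ¬Ra (R-resp (sym a≈b) Rb)
  first-exit {r} {v} {R} R-resp {a} (cons {y = y} _ w) in-ball ¬Ra Rb exit =
    ¬¬-excluded-middle continue
    where
    a→y : BallE r v a y
    a→y = in-ball (here refl refl)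

    a∈B : BallMinusV r v R a
    a∈B = ballE⇒ballV a→y , ¬Ra

    continue : Dec (R y) → ⊥
    continue (yes Ry) = exit (a , y , here refl refl , stay a∈B refl , ¬Ra , Ry)
    continue (no ¬Ry) = first-exit R-resp w (λ s → in-ball (there s)) ¬Ry Rb
      λ (c , d , s , y⇝c , ¬Rc , Rd) → exit (c , d , there s , step a∈B (a→y , ¬Ra , ¬Ry) y⇝c , ¬Rc , Rd)

  pair-in-morpheme≉ε : ∀ {w x y} → Morpheme w → ProperSubword (x ∷ y ∷ []) w → S x → S y → ¬ (x ∙ y ≈ ε)
  pair-in-morpheme≉ε {y = y} (_ , minimal) xy⊏w Sx Sy x∙y≈ε =
    minimal _ xy⊏w (Sx ∷ Sy ∷ [] , (λ ()) , trans (∙-congˡ (identityʳ y)) x∙y≈ε)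

  module _ (gs : GeneratingSet) where
    open GeneratingSet gs using (invClosed)

    adj-sym : ∀ {x y} → Adj x y → Adj y x
    adj-sym {x} {y} (s , Ss , y≈xs) = s ⁻¹ , invClosed Ss , x≈z//y x s y (sym y≈xs)

    neighbour∈ball : ∀ {r v x} → 2 ≤ r → Adj v x → BallV r v x
    neighbour∈ball 2≤r v→x = 2 , 2≤r , cons v→x (cons (adj-sym v→x) (nil refl)) , later (atHead refl)

    exit-connected : ∀ {r v₀ v₁ a c d x y n} {w : Walk x y n} → CV v₀ v₁ a → StepOn c d w →
                     SameComp r v₀ v₀ v₁ a c → ¬ Rem v₀ v₁ c → Rem v₀ v₁ d →
                     SameLocalComponent r v₀ v₁ a c
    exit-connected {v₀ = v₀} {v₁} {c = c} {d} cv-a c→d a⇝c ¬Rc Rd =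
      step cv-a (inj₁ a⇝c) (stay (¬Rc , neighbour Rd) refl)
      where
      d→c : Adj d c
      d→c = adj-sym (stepOn-adj c→d)

      neighbour : Rem v₀ v₁ d → Adj v₀ c ⊎ Adj v₁ c
      neighbour (inj₁ d≈v₀) = inj₁ (adj-respˡ d≈v₀ d→c)
      neighbour (inj₂ d≈v₁) = inj₂ (adj-respˡ d≈v₁ d→c)

module Configuration {c ℓ p} (Γ : Group c ℓ) (S : Pred (Group.Carrier Γ) p) (g h : Group.Carrier Γ) where
  open Group Γ
  open GroupProperties Γ
  open Cayley Γ S
  open GroupPowers Γ
  open Commutators Γ S
  open CayleyGraph Γ S
  open SetoidReasoning setoid
  open MonoidSolver monoid using (solve; _⊜_; _⊕_; id)

  G : Carrier
  G = g ⁻¹ ∙ g ⁻¹ ∙ h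

  u : Carrier
  u = h ∙ g

  module Relations (ghgh≈ε : prod (g ∷ h ∷ g ∷ h ∷ []) ≈ ε)
                   (g⁻¹hhg⁻¹h⁻¹≈ε : prod (g ⁻¹ ∷ h ∷ h ∷ g ⁻¹ ∷ h ⁻¹ ∷ []) ≈ ε) where

    ghg≈h⁻¹ : g ∙ h ∙ g ≈ h ⁻¹
    ghg≈h⁻¹ = inverseˡ-unique (g ∙ h ∙ g) h
      (trans (solve 2 (λ g h → ((g ⊕ h) ⊕ g) ⊕ h ⊜ g ⊕ (h ⊕ (g ⊕ (h ⊕ id)))) refl g h) ghgh≈ε)

    hgh≈g⁻¹ : h ∙ g ∙ h ≈ g ⁻¹
    hgh≈g⁻¹ = inverseʳ-unique g (h ∙ g ∙ h)
      (trans (solve 2 (λ g h → g ⊕ ((h ⊕ g) ⊕ h) ⊜ g ⊕ (h ⊕ (g ⊕ (h ⊕ id)))) refl g h) ghgh≈ε)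

    u∙u≈ε : u ∙ u ≈ ε
    u∙u≈ε = begin
      h ∙ g ∙ (h ∙ g)  ≈⟨ solve 2 (λ g h → (h ⊕ g) ⊕ (h ⊕ g) ⊜ ((h ⊕ g) ⊕ h) ⊕ g) refl g h ⟩
      h ∙ g ∙ h ∙ g    ≈⟨ ∙-congʳ hgh≈g⁻¹ ⟩
      g ⁻¹ ∙ g         ≈⟨ inverseˡ g ⟩
      ε                ∎

    g⁻¹∙h⁻¹≈u : g ⁻¹ ∙ h ⁻¹ ≈ u
    g⁻¹∙h⁻¹≈u = trans (sym (⁻¹-anti-homo-∙ h g)) (u⁻¹≈u u∙u≈ε)

    h∙h≈h⁻¹ : h ∙ h ≈ h ⁻¹
    h∙h≈h⁻¹ = begin
      h ∙ h        ≈⟨ x≈z//y (h ∙ h) u g hhu≈g ⟩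
      g ∙ u ⁻¹     ≈⟨ ∙-congˡ (u⁻¹≈u u∙u≈ε) ⟩
      g ∙ (h ∙ g)  ≈⟨ assoc g h g ⟨
      g ∙ h ∙ g    ≈⟨ ghg≈h⁻¹ ⟩
      h ⁻¹         ∎
      where
      hhu≈g : h ∙ h ∙ u ≈ g
      hhu≈g = begin
        h ∙ h ∙ u              ≈⟨ ∙-congˡ g⁻¹∙h⁻¹≈u ⟨
        h ∙ h ∙ (g ⁻¹ ∙ h ⁻¹)  ≈⟨ inverseʳ-unique (g ⁻¹) _ (trans (solve 3 (λ g⁻ h h⁻ →
                                    g⁻ ⊕ ((h ⊕ h) ⊕ (g⁻ ⊕ h⁻)) ⊜ g⁻ ⊕ (h ⊕ (h ⊕ (g⁻ ⊕ (h⁻ ⊕ id)))))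
                                    refl (g ⁻¹) h (h ⁻¹)) g⁻¹hhg⁻¹h⁻¹≈ε) ⟩
        g ⁻¹ ⁻¹                ≈⟨ ⁻¹-involutive g ⟩
        g                      ∎

    h⁻¹∙h⁻¹≈h : h ⁻¹ ∙ h ⁻¹ ≈ h
    h⁻¹∙h⁻¹≈h = trans (∙-congʳ (sym h∙h≈h⁻¹)) (//-rightDividesʳ h h)

    u-inverts-G : Inverts u G
    u-inverts-G = begin
      h ∙ g ∙ (g ⁻¹ ∙ g ⁻¹ ∙ h) ∙ (h ∙ g)
        ≈⟨ solve 3 (λ h g g⁻ → ((h ⊕ g) ⊕ ((g⁻ ⊕ g⁻) ⊕ h)) ⊕ (h ⊕ g) ⊜ (((h ⊕ (g ⊕ g⁻)) ⊕ g⁻) ⊕ (h ⊕ h)) ⊕ g)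
              refl h g (g ⁻¹) ⟩
      h ∙ (g ∙ g ⁻¹) ∙ g ⁻¹ ∙ (h ∙ h) ∙ g  ≈⟨ ∙-congʳ (∙-cong (∙-congʳ (∙-congˡ (inverseʳ g))) h∙h≈h⁻¹) ⟩
      h ∙ ε ∙ g ⁻¹ ∙ h ⁻¹ ∙ g
        ≈⟨ solve 4 (λ h g⁻ h⁻ g → (((h ⊕ id) ⊕ g⁻) ⊕ h⁻) ⊕ g ⊜ (h ⊕ (g⁻ ⊕ h⁻)) ⊕ g) refl h (g ⁻¹) (h ⁻¹) g ⟩
      h ∙ (g ⁻¹ ∙ h ⁻¹) ∙ g                 ≈⟨ ∙-congʳ (∙-congˡ g⁻¹∙h⁻¹≈u) ⟩
      h ∙ (h ∙ g) ∙ g                       ≈⟨ solve 2 (λ h g → (h ⊕ (h ⊕ g)) ⊕ g ⊜ (h ⊕ h) ⊕ (g ⊕ g)) refl h g ⟩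
      h ∙ h ∙ (g ∙ g)                       ≈⟨ ∙-congʳ h∙h≈h⁻¹ ⟩
      h ⁻¹ ∙ (g ∙ g)                        ≈⟨ ∙-congˡ (∙-cong (⁻¹-involutive g) (⁻¹-involutive g)) ⟨
      h ⁻¹ ∙ (g ⁻¹ ⁻¹ ∙ g ⁻¹ ⁻¹)            ≈⟨ ∙-congˡ (⁻¹-anti-homo-∙ (g ⁻¹) (g ⁻¹)) ⟨
      h ⁻¹ ∙ (g ⁻¹ ∙ g ⁻¹) ⁻¹               ≈⟨ ⁻¹-anti-homo-∙ (g ⁻¹ ∙ g ⁻¹) h ⟨
      (g ⁻¹ ∙ g ⁻¹ ∙ h) ⁻¹                  ∎

    G^i≉u : ¬ (h ∙ g ≈ ε) → ¬ (g ∙ h ≈ ε) → ∀ i → ¬ (G ^ᴳ i ≈ u)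
    G^i≉u hg≉ε gh≉ε i Gⁱ≈u = excluded (involution-powers G∙G≈ε i)
      where
      uG≈Gu : u ∙ G ≈ G ∙ u
      uG≈Gu = begin
        u ∙ G         ≈⟨ ∙-congʳ Gⁱ≈u ⟨
        G ^ᴳ i ∙ G    ≈⟨ ^ᴳ-comm G i ⟨
        G ∙ G ^ᴳ i    ≈⟨ ∙-congˡ Gⁱ≈u ⟩
        G ∙ u         ∎

      G⁻¹≈G : G ⁻¹ ≈ G
      G⁻¹≈G = begin
        G ⁻¹         ≈⟨ u-inverts-G ⟨
        u ∙ G ∙ u    ≈⟨ ∙-congʳ uG≈Gu ⟩
        G ∙ u ∙ u    ≈⟨ assoc G u u ⟩
        G ∙ (u ∙ u)  ≈⟨ ∙-congˡ u∙u≈ε ⟩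
        G ∙ ε        ≈⟨ identityʳ G ⟩
        G            ∎

      G∙G≈ε : G ∙ G ≈ ε
      G∙G≈ε = trans (∙-congˡ (sym G⁻¹≈G)) (inverseʳ G)

      excluded : G ^ᴳ i ≈ ε ⊎ G ^ᴳ i ≈ G → ⊥
      excluded (inj₁ Gⁱ≈ε) = hg≉ε (trans (sym Gⁱ≈u) Gⁱ≈ε)
      excluded (inj₂ Gⁱ≈G) = gh≉ε (trans (∙-congˡ (sym g⁻¹≈h)) (inverseʳ g))
        where
        g⁻¹∙h≈h⁻¹ : g ⁻¹ ∙ h ≈ h ⁻¹
        g⁻¹∙h≈h⁻¹ = ∙-cancelˡ (g ⁻¹) _ _ (begin
          g ⁻¹ ∙ (g ⁻¹ ∙ h)  ≈⟨ assoc (g ⁻¹) (g ⁻¹) h ⟨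
          G                  ≈⟨ Gⁱ≈G ⟨
          G ^ᴳ i             ≈⟨ Gⁱ≈u ⟩
          u                  ≈⟨ g⁻¹∙h⁻¹≈u ⟨
          g ⁻¹ ∙ h ⁻¹        ∎)

        g⁻¹≈h : g ⁻¹ ≈ h
        g⁻¹≈h = trans (x≈z//y (g ⁻¹) h (h ⁻¹) g⁻¹∙h≈h⁻¹) h⁻¹∙h⁻¹≈h

    G^m≉h∙h : ¬ (h ∙ h ≈ ε) → ∀ k → G ^ᴳ (2 ^ k) ≈ ε → ∀ m → ¬ (G ^ᴳ m ≈ h ∙ h)
    G^m≉h∙h hh≉ε k G^2^k≈ε m Gᵐ≈hh =
      hh≉ε (x∙x≈x⁻¹⇒x^2^k≈ε⇒x≈ε k hh∙hh≈[hh]⁻¹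
             (trans (^ᴳ-congˡ (2 ^ k) (sym Gᵐ≈hh)) (^ᴳ-^ᴳ-≈ε m (2 ^ k) G^2^k≈ε)))
      where
      hh∙hh≈[hh]⁻¹ : h ∙ h ∙ (h ∙ h) ≈ (h ∙ h) ⁻¹
      hh∙hh≈[hh]⁻¹ = begin
        h ∙ h ∙ (h ∙ h)  ≈⟨ ∙-cong h∙h≈h⁻¹ h∙h≈h⁻¹ ⟩
        h ⁻¹ ∙ h ⁻¹      ≈⟨ h⁻¹∙h⁻¹≈h ⟩
        h                ≈⟨ ⁻¹-involutive h ⟨
        h ⁻¹ ⁻¹          ≈⟨ ⁻¹-cong h∙h≈h⁻¹ ⟨
        (h ∙ h) ⁻¹       ∎

  module BlockWalk (gs : GeneratingSet) (r : ℕ) (Sg : S g) (Sh : S h) where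
    open GeneratingSet gs using (invClosed)

    x∙G≈x∙g⁻¹∙g⁻¹∙h : ∀ x → x ∙ G ≈ x ∙ g ⁻¹ ∙ g ⁻¹ ∙ h
    x∙G≈x∙g⁻¹∙g⁻¹∙h x = trans (sym (assoc x (g ⁻¹ ∙ g ⁻¹) h)) (∙-congʳ (sym (assoc x (g ⁻¹) (g ⁻¹))))

    next-block : ∀ {x} i → x ≈ G ^ᴳ i → x ∙ G ≈ G ^ᴳ suc i
    next-block i x≈Gⁱ = trans (∙-congʳ x≈Gⁱ) (sym (^ᴳ-comm G i))

    blocks  : ∀ m {x y} → x ∙ G ^ᴳ m ≈ y → Walk x y (m * 3)
    blocks⁺ : ∀ m {x y} → x ∙ G ^ᴳ suc m ≈ y → Walk (x ∙ g ⁻¹) y (suc (suc (m * 3)))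

    blocks zero    x∙ε≈y = nil (trans (sym (identityʳ _)) x∙ε≈y)
    blocks (suc m) x∙Gᵐ⁺¹≈y = cons (g ⁻¹ , invClosed Sg , refl) (blocks⁺ m x∙Gᵐ⁺¹≈y)

    blocks⁺ m {x} x∙Gᵐ⁺¹≈y =
      cons (g ⁻¹ , invClosed Sg , refl)
        (cons (h , Sh , x∙G≈x∙g⁻¹∙g⁻¹∙h x)
          (blocks m (trans (assoc x G (G ^ᴳ m)) x∙Gᵐ⁺¹≈y)))

    module _ (G^i≉hg : ∀ i → ¬ (G ^ᴳ i ≈ h ∙ g)) (G^m≉hh : ∀ m → ¬ (G ^ᴳ m ≈ h ∙ h)) where

      blocks-step : ∀ m i {x y c d} (e : x ∙ G ^ᴳ m ≈ y) → x ≈ G ^ᴳ i → StepOn c d (blocks m e) →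
                    (d ≈ c ∙ g ⁻¹ × ¬ (d ≈ h)) ⊎ d ≈ c ∙ h
      blocks-step (suc m) i {x} _ x≈Gⁱ (here c≈x d≈x∙g⁻¹) =
        inj₁ (trans d≈x∙g⁻¹ (∙-congʳ (sym c≈x)) , λ d≈h → G^i≉hg i (begin
          G ^ᴳ i          ≈⟨ x≈Gⁱ ⟨
          x               ≈⟨ x≈z//y x (g ⁻¹) h (trans (sym d≈x∙g⁻¹) d≈h) ⟩
          h ∙ g ⁻¹ ⁻¹     ≈⟨ ∙-congˡ (⁻¹-involutive g) ⟩
          h ∙ g           ∎))
      blocks-step (suc m) i {x} _ x≈Gⁱ (there (here c≈x∙g⁻¹ d≈x∙g⁻¹∙g⁻¹)) =
        inj₁ (trans d≈x∙g⁻¹∙g⁻¹ (∙-congʳ (sym c≈x∙g⁻¹)) , λ d≈h → G^m≉hh (suc i) (begin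
          G ^ᴳ suc i             ≈⟨ next-block i x≈Gⁱ ⟨
          x ∙ G                  ≈⟨ x∙G≈x∙g⁻¹∙g⁻¹∙h x ⟩
          x ∙ g ⁻¹ ∙ g ⁻¹ ∙ h    ≈⟨ ∙-congʳ (trans (sym d≈x∙g⁻¹∙g⁻¹) d≈h) ⟩
          h ∙ h                  ∎))
      blocks-step (suc m) i {x} _ _ (there (there (here c≈x∙g⁻¹∙g⁻¹ d≈x∙G))) =
        inj₂ (trans d≈x∙G (trans (x∙G≈x∙g⁻¹∙g⁻¹∙h x) (∙-congʳ (sym c≈x∙g⁻¹∙g⁻¹))))
      blocks-step (suc m) i _ x≈Gⁱ (there (there (there s))) =
        blocks-step m (suc i) _ (next-block i x≈Gⁱ) s

      G^K≉ε : CV ε h (ε ∙ g ⁻¹) →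
              ¬ SameLocalComponent r ε h (ε ∙ g ⁻¹) (ε ∙ g) →
              ¬ SameLocalComponent r ε h (ε ∙ g ⁻¹) (h ⁻¹) →
              ∀ K → .{{NonZero K}} → K * 3 ≤ r → ¬ (G ^ᴳ K ≈ ε)
      G^K≉ε cv-g⁻¹ g⁻¹≁g g⁻¹≁h⁻¹ (suc K) 3K≤r Gᴷ≈ε =
        first-exit Rem-resp (blocks⁺ K closed) (λ s → in-ball (there s)) (proj₁ cv-g⁻¹) (inj₁ refl)
          λ (c , d , c→d , g⁻¹⇝c , ¬Rc , Rd) →
            leaves (exit-connected gs cv-g⁻¹ c→d g⁻¹⇝c ¬Rc Rd) ¬Rc Rd
                   (blocks-step (suc K) 0 closed refl (there c→d))
        where
        closed : ε ∙ G ^ᴳ suc K ≈ ε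
        closed = trans (identityˡ _) Gᴷ≈ε

        in-ball : ∀ {c d} → StepOn c d (blocks (suc K) closed) → BallE r ε c d
        in-ball c→d = suc K * 3 , 3K≤r , blocks (suc K) closed , inj₁ c→d

        leaves : ∀ {c d} → SameLocalComponent r ε h (ε ∙ g ⁻¹) c → ¬ Rem ε h c → Rem ε h d →
                 (d ≈ c ∙ g ⁻¹ × ¬ (d ≈ h)) ⊎ d ≈ c ∙ h → ⊥
        leaves {c} g⁻¹⇝c _ (inj₁ d≈ε) (inj₁ (d≈c∙g⁻¹ , _)) = g⁻¹≁g (reach-≈ʳ g⁻¹⇝c (begin
          c          ≈⟨ inverseˡ-unique c (g ⁻¹) (trans (sym d≈c∙g⁻¹) d≈ε) ⟩
          g ⁻¹ ⁻¹    ≈⟨ ⁻¹-involutive g ⟩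
          g          ≈⟨ identityˡ g ⟨
          ε ∙ g      ∎))
        leaves _ _ (inj₂ d≈h) (inj₁ (_ , d≉h)) = d≉h d≈h
        leaves {c} g⁻¹⇝c _ (inj₁ d≈ε) (inj₂ d≈c∙h) =
          g⁻¹≁h⁻¹ (reach-≈ʳ g⁻¹⇝c (inverseˡ-unique c h (trans (sym d≈c∙h) d≈ε)))
        leaves {c} _ ¬Rc (inj₂ d≈h) (inj₂ d≈c∙h) =
          ¬Rc (inj₁ (identityˡ-unique c h (trans (sym d≈c∙h) d≈h)))

    strongly-traverses⇒separated : 2 ≤ r → ¬ (h ∙ h ≈ ε) → h ∙ h ≈ h ⁻¹ →
                                   StronglyTraverses r ε h g h h →
                                   ¬ SameLocalComponent r ε h (ε ∙ g ⁻¹) (h ⁻¹)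
    strongly-traverses⇒separated _ hh≉ε _ (v , inj₂ (v∙g≈h , v∙g∙h≈ε) , _) _ =
      hh≉ε (trans (∙-congʳ (sym v∙g≈h)) v∙g∙h≈ε)
    strongly-traverses⇒separated 2≤r _ hh≈h⁻¹ (v , inj₁ (v∙g≈ε , _) , cv-v , _ , v≁vghh) g⁻¹⇝h⁻¹ =
      v≁vghh (step cv-v (inj₁ (stay (neighbour∈ball gs 2≤r ε→v , proj₁ cv-v) v≈ε∙g⁻¹))
                        (reach-≈ʳ g⁻¹⇝h⁻¹ h⁻¹≈v∙g∙h∙h))
      where
      v≈ε∙g⁻¹ : v ≈ ε ∙ g ⁻¹
      v≈ε∙g⁻¹ = x≈z//y v g ε v∙g≈ε

      ε→v : Adj ε v
      ε→v = g ⁻¹ , invClosed Sg , v≈ε∙g⁻¹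

      h⁻¹≈v∙g∙h∙h : h ⁻¹ ≈ v ∙ g ∙ h ∙ h
      h⁻¹≈v∙g∙h∙h = begin
        h ⁻¹           ≈⟨ hh≈h⁻¹ ⟨
        h ∙ h          ≈⟨ ∙-congʳ (identityˡ h) ⟨
        ε ∙ h ∙ h      ≈⟨ ∙-congʳ (∙-congʳ v∙g≈ε) ⟨
        v ∙ g ∙ h ∙ h  ∎

proposition7p1 : {c ℓ p : Level} (Γ : Group c ℓ) (S : Pred (Group.Carrier Γ) p)
  (n r : ℕ) (h : Group.Carrier Γ) →
  Cayley.NilpotentClass≤ Γ S n →
  Cayley.GeneratingSet Γ S →
  2 ^ (n + 2) ≤ r →
  S h →
  Cayley.Local2Separator Γ S r (Group.ε Γ) h →
  (∀ v → ¬ Cayley.LocalCutvertex Γ S r v) →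
  ¬ (Group._≈_ Γ (Group._∙_ Γ h h) (Group.ε Γ)) →
  ¬ (Σ (Group.Carrier Γ) λ g → S g
      × Cayley.Traverses Γ S r (Group.ε Γ) h g (Group.ε Γ)
      × Cayley.StronglyTraverses Γ S r (Group.ε Γ) h g h h
      × Cayley.Morpheme Γ S (Group._⁻¹ Γ g ∷ h ∷ h ∷ Group._⁻¹ Γ g ∷ Group._⁻¹ Γ h ∷ [])
      × Cayley.Morpheme Γ S (g ∷ h ∷ g ∷ h ∷ []))
proposition7p1 Γ S n r h nilp gs 2ⁿ⁺²≤r Sh _ _ hh≉ε
  (g , Sg , (_ , cv-g⁻¹ , _ , g⁻¹≁g) , strong , ((_ , _ , g⁻¹hhg⁻¹h⁻¹≈ε) , _) , m₁@((_ , _ , ghgh≈ε) , _)) =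
  nilpotent⇒inverted-2^-torsion n nilp u∙u≈ε u-inverts-G λ G^2ⁿ≈ε →
    G^K≉ε (G^i≉u hg≉ε gh≉ε) (G^m≉h∙h hh≉ε n G^2ⁿ≈ε) cv-g⁻¹ g⁻¹≁g
      (strongly-traverses⇒separated 2≤r hh≉ε h∙h≈h⁻¹ strong) (2 ^ n) {{m^n≢0 2 n}} 2ⁿ*3≤r G^2ⁿ≈ε
  where
  open Group Γ using (_∙_; ε; _≈_)
  open Commutators Γ S using (nilpotent⇒inverted-2^-torsion)
  open CayleyGraph Γ S using (pair-in-morpheme≉ε)
  open Configuration Γ S g h
  open Relations ghgh≈ε g⁻¹hhg⁻¹h⁻¹≈ε
  open BlockWalk gs r Sg Sh

  gh≉ε : ¬ (g ∙ h ≈ ε)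
  gh≉ε = pair-in-morpheme≉ε m₁ ([] , g ∷ h ∷ [] , ≡.refl , (λ ()) , λ { (_ , ()) }) Sg Sh

  hg≉ε : ¬ (h ∙ g ≈ ε)
  hg≉ε = pair-in-morpheme≉ε m₁ (g ∷ [] , h ∷ [] , ≡.refl , (λ ()) , λ { (() , _) }) Sh Sg

  2ⁿ*3≤r : 2 ^ n * 3 ≤ r
  2ⁿ*3≤r = ≤-trans (*-monoʳ-≤ (2 ^ n) (n≤1+n 3)) (≤-trans (≤-reflexive (≡.sym (^-distribˡ-+-* 2 n 2))) 2ⁿ⁺²≤r)

  2≤r : 2 ≤ r
  2≤r = ≤-trans (s≤s (s≤s z≤n)) (≤-trans (^-monoʳ-≤ 2 (m≤n+m 2 n)) 2ⁿ⁺²≤r)
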